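{- Let $P_n=v_1\cdots v_n$ be a path and let $w,w'$ be two assignments of nonnegative integer initial weights to its vertices that agree on all vertices except possibly one. Then the total acquisition numbers of $P_n$ under $w$ and under $w'$ differ by at most $1$.
   Context: Let $G$ be a graph whose vertices carry nonnegative integer weights $w(v)$. An acquisition move consists of choosing adjacent vertices $u,v$ with current weights satisfying $w(u)\ge w(v)>0$ and transferring all of the weight of $v$ to $u$. A sequence of acquisition moves after which no further move is possible is an acquisition protocol; the set of vertices with nonzero weight at its end is the residual set. The total acquisition number $a_t(G)$ is the minimum size of a residual set over all acquisition protocols. -}

module Defs where

open import Data.Nat using (ℕ; zero; suc; _+_; _≤_; _<_; _<?_)
open import Data.Fin using (Fin; toℕ; _≟_)
open import Data.List using (List; length; filter; allFin)
open import Data.Product using (∃; ∃-syntax; _×_; _,_)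
open import Data.Sum using (_⊎_)
open import Relation.Nullary using (¬_; yes; no)
open import Relation.Binary.PropositionalEquality using (_≡_; _≢_)
open import Relation.Binary.Construct.Closure.ReflexiveTransitive using (Star)

-- The path P_n: vertices v_1 … v_n are Fin n (v_{i+1} ↦ i);
-- consecutive vertices are adjacent.
PathAdj : ∀ {n} → Fin n → Fin n → Set
PathAdj i j = toℕ j ≡ suc (toℕ i) ⊎ toℕ i ≡ suc (toℕ j)

Weights : ℕ → Set
Weights n = Fin n → ℕ

transfer : ∀ {n} → Weights n → Fin n → Fin n → Weights n
transfer w u v x with x ≟ v
... | yes _ = 0
... | no _ with x ≟ u
...   | yes _ = w u + w v
...   | no _ = w x

data Move {n : ℕ} (w : Weights n) : Weights n → Set where
  move : (u v : Fin n) → PathAdj u v → w v ≤ w u → 0 < w v →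
         Move w (transfer w u v)

Moves : ∀ {n} → Weights n → Weights n → Set
Moves = Star Move

Terminal : ∀ {n} → Weights n → Set
Terminal w = ¬ (∃[ w' ] Move w w')

residualSize : ∀ {n} → Weights n → ℕ
residualSize {n} w = length (filter (λ i → 0 <? w i) (allFin n))

HasProtocolWithResidual : ∀ {n} → Weights n → ℕ → Set
HasProtocolWithResidual w k =
  ∃[ w' ] (Moves w w' × Terminal w' × residualSize w' ≡ k)

IsTotalAcqNum : ∀ {n} → Weights n → ℕ → Set
IsTotalAcqNum w k =
  HasProtocolWithResidual w k ×
  (∀ k' → HasProtocolWithResidual w k' → k ≤ k')

AgreeExceptOne : ∀ {n} → Weights n → Weights n → Set
AgreeExceptOne {n} w w' = ∃[ v ] (∀ (u : Fin n) → u ≢ v → w u ≡ w' u)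

-- Let a protocol for w run and make a protocol for w′ shadow it move by move. The two
-- configurations stay coupled: they agree except at a pivot vertex and at most two leftover
-- vertices that are empty in the original, and while the pivot still has a nonempty neighbour
-- the shadow's pivot weight is positive and at most the original's. A vertex of a path has
-- only two neighbours, so once the pivot has acquired one of them at most one nonempty
-- neighbour remains, and the shadow can always answer a move by copying it, by reversing it,
-- or by waiting. Each coupling leaves the shadow with at most one nonempty vertex more than
-- the original, and finishing the shadow greedily only removes nonempty vertices; hence
-- a_t(w′) ≤ a_t(w) + 1, and symmetrically.

module Submission where

open import Defs
open import Data.Nat using (ℕ; zero; suc; _+_; _≤_; _<_; z≤n; s≤s; z<s; s≤s⁻¹; _<?_; _≤?_)
open import Data.Nat.Properties hiding (_≟_)
open import Data.Fin using (Fin; toℕ; _≟_) renaming (zero to fzero; suc to fsuc)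
open import Data.Fin.Properties using (toℕ-injective; any?) renaming (suc-injective to fsuc-injective)
open import Data.List using (length; filter; tabulate)
open import Data.Product using (∃-syntax; _×_; _,_; proj₁; proj₂) renaming (map to map-×)
open import Data.Sum using (_⊎_; inj₁; inj₂; [_,_]′; map₁)
open import Function using (_∘_; id)
open import Relation.Nullary using (Dec; yes; no; ¬_; contradiction)
open import Relation.Nullary.Decidable using (_×-dec_; _⊎-dec_)
open import Relation.Binary.PropositionalEquality
open import Relation.Binary.Construct.Closure.ReflexiveTransitive using (ε; _◅_; _◅◅_; return)

sgn : ℕ → ℕ
sgn zero    = 0
sgn (suc _) = 1

sgn-mono : ∀ {a b} → (0 < a → 0 < b) → sgn a ≤ sgn b
sgn-mono {zero}          _   = z≤n
sgn-mono {suc a} {zero}  0<b = contradiction (0<b z<s) n≮0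
sgn-mono {suc a} {suc b} _   = ≤-refl

sgn≤1 : ∀ a → sgn a ≤ 1
sgn≤1 zero    = z≤n
sgn≤1 (suc a) = ≤-refl

supportSize : ∀ {n} → Weights n → ℕ
supportSize {zero}  w = 0
supportSize {suc n} w = sgn (w fzero) + supportSize (w ∘ fsuc)

length-filter-tabulate : ∀ {m n} (w : Weights n) (g : Fin m → Fin n) →
  length (filter (λ i → 0 <? w i) (tabulate g)) ≡ supportSize (w ∘ g)
length-filter-tabulate {zero}  w g = refl
length-filter-tabulate {suc m} w g with w (g fzero) | length-filter-tabulate w (g ∘ fsuc)
... | zero  | eq = eq
... | suc _ | eq = cong suc eq

residualSize≡supportSize : ∀ {n} (w : Weights n) → residualSize w ≡ supportSize w
residualSize≡supportSize w = length-filter-tabulate w id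

supportSize-mono : ∀ {n} {d c : Weights n} → (∀ i → 0 < d i → 0 < c i) →
  supportSize d ≤ supportSize c
supportSize-mono {zero}  _    = z≤n
supportSize-mono {suc n} live = +-mono-≤ (sgn-mono (live fzero)) (supportSize-mono (live ∘ fsuc))

supportSize-≤-suc : ∀ {n} {d c : Weights n} e → (∀ i → i ≢ e → 0 < d i → 0 < c i) →
  supportSize d ≤ suc (supportSize c)
supportSize-≤-suc {suc n} {d} {c} fzero live = begin
  sgn (d fzero) + supportSize (d ∘ fsuc) ≤⟨ +-mono-≤ (sgn≤1 (d fzero)) (supportSize-mono (λ i → live (fsuc i) λ ())) ⟩
  1 + supportSize (c ∘ fsuc)             ≤⟨ s≤s (m≤n+m _ (sgn (c fzero))) ⟩
  suc (supportSize c)                    ∎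
  where open ≤-Reasoning
supportSize-≤-suc {suc n} {d} {c} (fsuc e) live = begin
  sgn (d fzero) + supportSize (d ∘ fsuc)       ≤⟨ +-mono-≤ (sgn-mono (live fzero λ ()))
                                                     (supportSize-≤-suc e λ i i≢e → live (fsuc i) (i≢e ∘ fsuc-injective)) ⟩
  sgn (c fzero) + suc (supportSize (c ∘ fsuc)) ≡⟨ +-suc (sgn (c fzero)) _ ⟩
  suc (supportSize c)                          ∎
  where open ≤-Reasoning

supportSize-< : ∀ {n} {d c : Weights n} e → (∀ i → i ≢ e → 0 < d i → 0 < c i) →
  0 < c e → d e ≡ 0 → supportSize d < supportSize c
supportSize-< {suc n} {d} {c} fzero live 0<ce de≡0 with c fzero | d fzero
supportSize-< fzero live ()  _    | zero  | _
supportSize-< fzero live 0<ce refl | suc _ | zero = s≤s (supportSize-mono λ i → live (fsuc i) λ ())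
supportSize-< {suc n} {d} {c} (fsuc e) live 0<ce de≡0 = begin-strict
  sgn (d fzero) + supportSize (d ∘ fsuc) <⟨ +-mono-≤-< (sgn-mono (live fzero λ ()))
                                              (supportSize-< e (λ i i≢e → live (fsuc i) (i≢e ∘ fsuc-injective)) 0<ce de≡0) ⟩
  sgn (c fzero) + supportSize (c ∘ fsuc) ∎
  where open ≤-Reasoning

erase : ∀ {n} → Fin n → Weights n → Weights n
erase e w i with i ≟ e
... | yes _ = 0
... | no  _ = w i

erase-self : ∀ {n} e (w : Weights n) → erase e w e ≡ 0
erase-self e w with e ≟ e
... | yes _   = refl
... | no e≢e = contradiction refl e≢e

erase-other : ∀ {n} {e i} (w : Weights n) → i ≢ e → erase e w i ≡ w i
erase-other {e = e} {i} w i≢e with i ≟ e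
... | yes i≡e = contradiction i≡e i≢e
... | no  _   = refl

erase-live⇒≢ : ∀ {n} {e i} (w : Weights n) → 0 < erase e w i → i ≢ e
erase-live⇒≢ {e = e} w 0<i refl = n>0⇒n≢0 0<i (erase-self e w)

supportSize-erase : ∀ {n} e (w : Weights n) → supportSize w ≤ suc (supportSize (erase e w))
supportSize-erase e w = supportSize-≤-suc e λ i i≢e → subst (0 <_) (sym (erase-other w i≢e))

supportSize-erase-< : ∀ {n} {e} (w : Weights n) → 0 < w e → supportSize (erase e w) < supportSize w
supportSize-erase-< {e = e} w 0<e =
  supportSize-< e (λ i i≢e → subst (0 <_) (erase-other w i≢e)) 0<e (erase-self e w)

transfer-source : ∀ {n} (w : Weights n) u v → transfer w u v v ≡ 0
transfer-source w u v with v ≟ v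
... | yes _   = refl
... | no v≢v = contradiction refl v≢v

transfer-target : ∀ {n} (w : Weights n) u v → u ≢ v → transfer w u v u ≡ w u + w v
transfer-target w u v u≢v with u ≟ v
... | yes u≡v = contradiction u≡v u≢v
... | no  _ with u ≟ u
...   | yes _   = refl
...   | no u≢u = contradiction refl u≢u

transfer-target-≥ : ∀ {n} (w : Weights n) u v → u ≢ v → w u ≤ transfer w u v u
transfer-target-≥ w u v u≢v = subst (w u ≤_) (sym (transfer-target w u v u≢v)) (m≤m+n (w u) (w v))

transfer-other : ∀ {n} (w : Weights n) u v x → x ≢ v → x ≢ u → transfer w u v x ≡ w x
transfer-other w u v x x≢v x≢u with x ≟ v
... | yes x≡v = contradiction x≡v x≢v
... | no  _ with x ≟ u
...   | yes x≡u = contradiction x≡u x≢u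
...   | no  _   = refl

transfer-cong : ∀ {n} (c d : Weights n) u v x → c u ≡ d u → c v ≡ d v → c x ≡ d x →
  transfer c u v x ≡ transfer d u v x
transfer-cong c d u v x cu≡du cv≡dv cx≡dx with x ≟ v
... | yes _ = refl
... | no  _ with x ≟ u
...   | yes _ = cong₂ _+_ cu≡du cv≡dv
...   | no  _ = cx≡dx

transfer-cong-≢target : ∀ {n} (c d : Weights n) u v x → x ≢ u → (x ≢ v → c x ≡ d x) →
  transfer c u v x ≡ transfer d u v x
transfer-cong-≢target c d u v x x≢u cx≡dx with x ≟ v
... | yes _   = refl
... | no  x≢v with x ≟ u
...   | yes x≡u = contradiction x≡u x≢u
...   | no  _   = cx≡dx x≢v

transfer-≡-≢target : ∀ {n} (c d : Weights n) u v x → x ≢ u → d v ≡ 0 → (x ≢ v → c x ≡ d x) →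
  transfer c u v x ≡ d x
transfer-≡-≢target c d u v x x≢u dv≡0 cx≡dx with x ≟ v
... | yes refl = sym dv≡0
... | no  x≢v with x ≟ u
...   | yes x≡u = contradiction x≡u x≢u
...   | no  _   = cx≡dx x≢v

transfer-preserves-empty : ∀ {n} (w : Weights n) u v x → 0 < w u → w x ≡ 0 → transfer w u v x ≡ 0
transfer-preserves-empty w u v x 0<u x≡0 with x ≟ v
... | yes _ = refl
... | no  _ with x ≟ u
...   | yes refl = contradiction x≡0 (n>0⇒n≢0 0<u)
...   | no  _    = x≡0

transfer-live⇒live : ∀ {n} (w : Weights n) u v x → 0 < w u → 0 < transfer w u v x → 0 < w x
transfer-live⇒live w u v x 0<u 0<x with x ≟ v
... | yes _ = contradiction 0<x n≮0
... | no  _ with x ≟ u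
...   | yes refl = 0<u
...   | no  _    = 0<x

transfer-live⇒≢source : ∀ {n} (w : Weights n) u v x → 0 < transfer w u v x → x ≢ v
transfer-live⇒≢source w u v x 0<x refl = n>0⇒n≢0 0<x (transfer-source w u x)

live⇒≢empty : ∀ {n} {w : Weights n} {i j} → 0 < w i → w j ≡ 0 → i ≢ j
live⇒≢empty 0<i j≡0 refl = n>0⇒n≢0 0<i j≡0

PathAdj-sym : ∀ {n} {a b : Fin n} → PathAdj a b → PathAdj b a
PathAdj-sym (inj₁ eq) = inj₂ eq
PathAdj-sym (inj₂ eq) = inj₁ eq

PathAdj⇒≢ : ∀ {n} {a b : Fin n} → PathAdj a b → a ≢ b
PathAdj⇒≢ (inj₁ eq) refl = 1+n≢n (sym eq)
PathAdj⇒≢ (inj₂ eq) refl = 1+n≢n (sym eq)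

PathAdj-unique-other : ∀ {n} {a b s r : Fin n} → PathAdj a b → PathAdj a s → PathAdj a r →
  s ≢ b → r ≢ b → s ≡ r
PathAdj-unique-other (inj₁ b≡) (inj₁ s≡) _ s≢b _ = contradiction (toℕ-injective (trans s≡ (sym b≡))) s≢b
PathAdj-unique-other (inj₂ b≡) (inj₂ s≡) _ s≢b _ = contradiction (toℕ-injective (suc-injective (trans (sym s≡) b≡))) s≢b
PathAdj-unique-other (inj₁ b≡) _ (inj₁ r≡) _ r≢b = contradiction (toℕ-injective (trans r≡ (sym b≡))) r≢b
PathAdj-unique-other (inj₂ b≡) _ (inj₂ r≡) _ r≢b = contradiction (toℕ-injective (suc-injective (trans (sym r≡) b≡))) r≢b
PathAdj-unique-other (inj₁ _) (inj₂ s≡) (inj₂ r≡) _ _ = toℕ-injective (suc-injective (trans (sym s≡) r≡))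
PathAdj-unique-other (inj₂ _) (inj₁ s≡) (inj₁ r≡) _ _ = toℕ-injective (trans s≡ (sym r≡))

PathAdj? : ∀ {n} (a b : Fin n) → Dec (PathAdj a b)
PathAdj? a b = (toℕ b Data.Nat.≟ suc (toℕ a)) ⊎-dec (toℕ a Data.Nat.≟ suc (toℕ b))

mirror-move : ∀ {n} {c d : Weights n} {u x} → PathAdj u x → c x ≤ c u → 0 < c x →
  c u ≡ d u → c x ≡ d x → Move d (transfer d u x)
mirror-move {u = u} {x} u~x x≤u 0<x cu≡du cx≡dx =
  move u x u~x (subst₂ _≤_ cx≡dx cu≡du x≤u) (subst (0 <_) cx≡dx 0<x)

emptyInto : ∀ {n} (d : Weights n) {p x} → PathAdj p x → d p ≤ d x →
  ∃[ d′ ] (Moves d d′ × d′ p ≡ 0 × (∀ i → i ≢ p → i ≢ x → d i ≡ d′ i))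
emptyInto d {p} {x} p~x p≤x with d p Data.Nat.≟ 0
... | yes p≡0 = d , ε , p≡0 , λ _ _ _ → refl
... | no  p≢0 = transfer d x p , return (move x p (PathAdj-sym p~x) p≤x (n≢0⇒n>0 p≢0)) ,
  transfer-source d x p , λ i i≢p i≢x → sym (transfer-other d x p i i≢p i≢x)

AtMostOneLiveNeighbour : ∀ {n} → Weights n → Fin n → Set
AtMostOneLiveNeighbour {n} w p =
  ∀ (q r : Fin n) → PathAdj p q → PathAdj p r → 0 < w q → 0 < w r → q ≡ r

transfer-sparse : ∀ {n} (w : Weights n) {u v} → PathAdj u v → AtMostOneLiveNeighbour (transfer w u v) u
transfer-sparse w {u} {v} u~v q r u~q u~r 0<q 0<r =
  PathAdj-unique-other u~v u~q u~r (transfer-live⇒≢source w u v q 0<q) (transfer-live⇒≢source w u v r 0<r)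

sparse-transfer : ∀ {n} (w : Weights n) {u v p} → 0 < w u →
  AtMostOneLiveNeighbour w p → AtMostOneLiveNeighbour (transfer w u v) p
sparse-transfer w {u} {v} 0<u sparse q r p~q p~r 0<q 0<r =
  sparse q r p~q p~r (transfer-live⇒live w u v q 0<u 0<q) (transfer-live⇒live w u v r 0<u 0<r)

transfer-isolates : ∀ {n} (w : Weights n) {p v} → AtMostOneLiveNeighbour w p → PathAdj p v → 0 < w v →
  ∀ q → PathAdj p q → ¬ 0 < transfer w p v q
transfer-isolates w {p} {v} sparse p~v 0<v q p~q 0<q′ = q≢v (sparse q v p~q p~v 0<q 0<v)
  where
  q≢v = transfer-live⇒≢source w p v q 0<q′
  0<q = subst (0 <_) (transfer-other w p v q q≢v (PathAdj⇒≢ (PathAdj-sym p~q))) 0<q′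

move? : ∀ {n} (w : Weights n) → Dec (∃[ w′ ] Move w w′)
move? w with any? (λ u → any? (λ v → PathAdj? u v ×-dec (w v ≤? w u) ×-dec (0 <? w v)))
... | yes (u , v , u~v , v≤u , 0<v) = yes (transfer w u v , move u v u~v v≤u 0<v)
... | no  stuck = no λ { (_ , move u v u~v v≤u 0<v) → stuck (u , v , u~v , v≤u , 0<v) }

move-shrinks-support : ∀ {n} {w w′ : Weights n} → Move w w′ → supportSize w′ < supportSize w
move-shrinks-support {w = w} (move u v _ v≤u 0<v) =
  supportSize-< v (λ i _ → transfer-live⇒live w u v i (<-≤-trans 0<v v≤u)) 0<v (transfer-source w u v)

reachTerminal : ∀ {n} (w : Weights n) → ∃[ t ] (Moves w t × Terminal t × supportSize t ≤ supportSize w)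
reachTerminal w = go (suc (supportSize w)) w ≤-refl
  where
  go : ∀ {n} k (w : Weights n) → supportSize w < k →
    ∃[ t ] (Moves w t × Terminal t × supportSize t ≤ supportSize w)
  go zero    w ()
  go (suc k) w ∣w∣<1+k with move? w
  ... | no  stuck = w , ε , stuck , ≤-refl
  ... | yes (w′ , w→w′) with go k w′ (<-≤-trans (move-shrinks-support w→w′) (s≤s⁻¹ ∣w∣<1+k))
  ...   | t , w′→t , terminal , ∣t∣≤∣w′∣ =
    t , w→w′ ◅ w′→t , terminal , ≤-trans ∣t∣≤∣w′∣ (<⇒≤ (move-shrinks-support w→w′))

record OneLeftover {n} (c d : Weights n) : Set where
  field
    pivot leftover : Fin n
    agree          : ∀ i → i ≢ pivot → i ≢ leftover → c i ≡ d i
    c-leftover     : c leftover ≡ 0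
    d-pivot        : d pivot ≡ 0
    sparse         : AtMostOneLiveNeighbour c pivot

record TwoLeftovers {n} (c d : Weights n) : Set where
  field
    pivot leftover₁ leftover₂ : Fin n
    agree       : ∀ i → i ≢ pivot → i ≢ leftover₁ → i ≢ leftover₂ → c i ≡ d i
    c-leftover₁ : c leftover₁ ≡ 0
    c-leftover₂ : c leftover₂ ≡ 0
    -- keeps the shadow at most one nonempty vertex ahead despite two leftovers
    slack       : d pivot ≡ 0 ⊎ leftover₁ ≡ leftover₂
    c-pivot     : 0 < c pivot
    lagging     : ∀ q → PathAdj pivot q → 0 < c q → 0 < d pivot × d pivot ≤ c pivot
    sparse      : AtMostOneLiveNeighbour c pivot

-- c is the configuration of the protocol being shadowed, d that of the shadow.
data Coupling {n} (c d : Weights n) : Set where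
  agreeing     : AgreeExceptOne c d → Coupling c d
  oneLeftover  : OneLeftover c d → Coupling c d
  twoLeftovers : TwoLeftovers c d → Coupling c d

Trackable : ∀ {n} → Weights n → Weights n → Set
Trackable c d = ∃[ d′ ] (Moves d d′ × Coupling c d′)

module AgreeingStep {n} {c d : Weights n} (p : Fin n) (agree : ∀ i → i ≢ p → c i ≡ d i) where

  away : ∀ {u x} → PathAdj u x → c x ≤ c u → 0 < c x → u ≢ p → x ≢ p → Trackable (transfer c u x) d
  away {u} {x} u~x x≤u 0<x u≢p x≢p =
    transfer d u x , return (mirror-move u~x x≤u 0<x (agree u u≢p) (agree x x≢p)) ,
    agreeing (p , λ i i≢p → transfer-cong c d u x i (agree u u≢p) (agree x x≢p) (agree i i≢p))

  absorbPivot : ∀ {u} → PathAdj u p → c p ≤ c u → 0 < c p → Trackable (transfer c u p) d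
  absorbPivot {u} u~p p≤u 0<p = d , ε , twoLeftovers record
    { pivot       = u
    ; leftover₁   = p
    ; leftover₂   = p
    ; agree       = λ i i≢u i≢p _ → trans (transfer-other c u p i i≢p i≢u) (agree i i≢p)
    ; c-leftover₁ = transfer-source c u p
    ; c-leftover₂ = transfer-source c u p
    ; slack       = inj₂ refl
    ; c-pivot     = <-≤-trans 0<u (transfer-target-≥ c u p u≢p)
    ; lagging     = λ _ _ _ → subst (0 <_) cu≡du 0<u ,
                              subst (_≤ _) cu≡du (transfer-target-≥ c u p u≢p)
    ; sparse      = transfer-sparse c u~p
    }
    where
    u≢p   = PathAdj⇒≢ u~p
    0<u   = <-≤-trans 0<p p≤u
    cu≡du = agree u u≢p

  copyAbsorption : ∀ {x} → PathAdj p x → 0 < d x → d x ≤ d p → Trackable (transfer c p x) d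
  copyAbsorption {x} p~x 0<dx dx≤dp =
    transfer d p x , return (move p x p~x dx≤dp 0<dx) ,
    agreeing (p , λ i i≢p → transfer-cong-≢target c d p x i i≢p (λ _ → agree i i≢p))

  displaceAbsorption : ∀ {x} → PathAdj p x → d p ≤ d x → Trackable (transfer c p x) d
  displaceAbsorption {x} p~x dp≤dx with emptyInto d p~x dp≤dx
  ... | d′ , d→d′ , d′p≡0 , d≡d′ = d′ , d→d′ , oneLeftover record
    { pivot      = p
    ; leftover   = x
    ; agree      = λ i i≢p i≢x → trans (transfer-other c p x i i≢x i≢p) (trans (agree i i≢p) (d≡d′ i i≢p i≢x))
    ; c-leftover = transfer-source c p x
    ; d-pivot    = d′p≡0
    ; sparse     = transfer-sparse c p~x
    }

  pivotAbsorbs : ∀ {x} → PathAdj p x → 0 < c x → Trackable (transfer c p x) d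
  pivotAbsorbs {x} p~x 0<x with d x ≤? d p
  ... | yes dx≤dp = copyAbsorption p~x (subst (0 <_) (agree x (≢-sym (PathAdj⇒≢ p~x))) 0<x) dx≤dp
  ... | no  dx≰dp = displaceAbsorption p~x (<⇒≤ (≰⇒> dx≰dp))

  step : ∀ {c₁} → Move c c₁ → Trackable c₁ d
  step (move u x u~x x≤u 0<x) with u ≟ p | x ≟ p
  ... | no  u≢p | no x≢p = away u~x x≤u 0<x u≢p x≢p
  ... | _       | yes refl = absorbPivot u~x x≤u 0<x
  ... | yes refl | no _    = pivotAbsorbs u~x 0<x

module OneLeftoverStep {n} {c d : Weights n} (o : OneLeftover c d) where
  open OneLeftover o

  agree-live : ∀ {i} → 0 < c i → i ≢ pivot → c i ≡ d i
  agree-live 0<i i≢p = agree _ i≢p (live⇒≢empty 0<i c-leftover)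

  away : ∀ {u x} → PathAdj u x → c x ≤ c u → 0 < c x → u ≢ pivot → x ≢ pivot →
         Trackable (transfer c u x) d
  away {u} {x} u~x x≤u 0<x u≢p x≢p =
    transfer d u x , return (mirror-move u~x x≤u 0<x cu≡du cx≡dx) , oneLeftover record
    { pivot      = pivot
    ; leftover   = leftover
    ; agree      = λ i i≢p i≢e → transfer-cong c d u x i cu≡du cx≡dx (agree i i≢p i≢e)
    ; c-leftover = transfer-preserves-empty c u x leftover 0<u c-leftover
    ; d-pivot    = trans (transfer-other d u x pivot (≢-sym x≢p) (≢-sym u≢p)) d-pivot
    ; sparse     = sparse-transfer c 0<u sparse
    }
    where
    0<u   = <-≤-trans 0<x x≤u
    cu≡du = agree-live 0<u u≢p
    cx≡dx = agree-live 0<x x≢p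

  absorbPivot : ∀ {u} → PathAdj u pivot → c pivot ≤ c u → 0 < c pivot → Trackable (transfer c u pivot) d
  absorbPivot {u} u~p p≤u 0<p = d , ε , twoLeftovers record
    { pivot       = u
    ; leftover₁   = leftover
    ; leftover₂   = leftover
    ; agree       = agree′
    ; c-leftover₁ = transfer-preserves-empty c u pivot leftover 0<u c-leftover
    ; c-leftover₂ = transfer-preserves-empty c u pivot leftover 0<u c-leftover
    ; slack       = inj₂ refl
    ; c-pivot     = <-≤-trans 0<u (transfer-target-≥ c u pivot u≢p)
    ; lagging     = λ _ _ _ → subst (0 <_) cu≡du 0<u ,
                              subst (_≤ _) cu≡du (transfer-target-≥ c u pivot u≢p)
    ; sparse      = transfer-sparse c u~p
    }
    where
    u≢p   = PathAdj⇒≢ u~p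
    0<u   = <-≤-trans 0<p p≤u
    cu≡du = agree-live 0<u u≢p
    agree′ : ∀ i → i ≢ u → i ≢ leftover → i ≢ leftover → transfer c u pivot i ≡ d i
    agree′ i i≢u i≢e _ = transfer-≡-≢target c d u pivot i i≢u d-pivot λ i≢p → agree i i≢p i≢e

  pivotAbsorbs : ∀ {x} → PathAdj pivot x → c x ≤ c pivot → 0 < c x → Trackable (transfer c pivot x) d
  pivotAbsorbs {x} p~x x≤p 0<x = d , ε , twoLeftovers record
    { pivot       = pivot
    ; leftover₁   = x
    ; leftover₂   = leftover
    ; agree       = λ i i≢p i≢x i≢e → trans (transfer-other c pivot x i i≢x i≢p) (agree i i≢p i≢e)
    ; c-leftover₁ = transfer-source c pivot x
    ; c-leftover₂ = transfer-preserves-empty c pivot x leftover 0<p c-leftover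
    ; slack       = inj₁ d-pivot
    ; c-pivot     = <-≤-trans 0<p (transfer-target-≥ c pivot x (PathAdj⇒≢ p~x))
    ; lagging     = λ q p~q 0<q → contradiction 0<q (transfer-isolates c sparse p~x 0<x q p~q)
    ; sparse      = transfer-sparse c p~x
    }
    where 0<p = <-≤-trans 0<x x≤p

  step : ∀ {c₁} → Move c c₁ → Trackable c₁ d
  step (move u x u~x x≤u 0<x) with u ≟ pivot | x ≟ pivot
  ... | no  u≢p  | no x≢p = away u~x x≤u 0<x u≢p x≢p
  ... | _        | yes refl = absorbPivot u~x x≤u 0<x
  ... | yes refl | no _    = pivotAbsorbs u~x x≤u 0<x

module TwoLeftoversStep {n} {c d : Weights n} (t : TwoLeftovers c d) where
  open TwoLeftovers t

  agree-live : ∀ {i} → 0 < c i → i ≢ pivot → c i ≡ d i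
  agree-live 0<i i≢p = agree _ i≢p (live⇒≢empty 0<i c-leftover₁) (live⇒≢empty 0<i c-leftover₂)

  leftovers-coincide : 0 < d pivot → leftover₁ ≡ leftover₂
  leftovers-coincide 0<dp = [ (λ dp≡0 → contradiction dp≡0 (n>0⇒n≢0 0<dp)) , id ]′ slack

  away : ∀ {u x} → PathAdj u x → c x ≤ c u → 0 < c x → u ≢ pivot → x ≢ pivot →
         Trackable (transfer c u x) d
  away {u} {x} u~x x≤u 0<x u≢p x≢p =
    transfer d u x , return (mirror-move u~x x≤u 0<x cu≡du cx≡dx) , twoLeftovers record
    { pivot       = pivot
    ; leftover₁   = leftover₁
    ; leftover₂   = leftover₂
    ; agree       = λ i i≢p i≢e₁ i≢e₂ → transfer-cong c d u x i cu≡du cx≡dx (agree i i≢p i≢e₁ i≢e₂)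
    ; c-leftover₁ = transfer-preserves-empty c u x leftover₁ 0<u c-leftover₁
    ; c-leftover₂ = transfer-preserves-empty c u x leftover₂ 0<u c-leftover₂
    ; slack       = map₁ (trans d-pivot-same) slack
    ; c-pivot     = subst (0 <_) (sym c-pivot-same) c-pivot
    ; lagging     = λ q p~q 0<q → map-× (subst (0 <_) (sym d-pivot-same))
                                        (subst₂ _≤_ (sym d-pivot-same) (sym c-pivot-same))
                                        (lagging q p~q (transfer-live⇒live c u x q 0<u 0<q))
    ; sparse      = sparse-transfer c 0<u sparse
    }
    where
    0<u          = <-≤-trans 0<x x≤u
    cu≡du        = agree-live 0<u u≢p
    cx≡dx        = agree-live 0<x x≢p
    c-pivot-same = transfer-other c u x pivot (≢-sym x≢p) (≢-sym u≢p)
    d-pivot-same = transfer-other d u x pivot (≢-sym x≢p) (≢-sym u≢p)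

  absorbPivot : ∀ {u} → PathAdj u pivot → c pivot ≤ c u → Trackable (transfer c u pivot) d
  absorbPivot {u} u~p p≤u =
    transfer d u pivot , return (move u pivot u~p dp≤du 0<dp) , twoLeftovers record
    { pivot       = u
    ; leftover₁   = leftover₁
    ; leftover₂   = leftover₂
    ; agree       = λ i i≢u i≢e₁ i≢e₂ → transfer-cong-≢target c d u pivot i i≢u λ i≢p → agree i i≢p i≢e₁ i≢e₂
    ; c-leftover₁ = transfer-preserves-empty c u pivot leftover₁ 0<u c-leftover₁
    ; c-leftover₂ = transfer-preserves-empty c u pivot leftover₂ 0<u c-leftover₂
    ; slack       = inj₂ (leftovers-coincide 0<dp)
    ; c-pivot     = <-≤-trans 0<u (transfer-target-≥ c u pivot u≢p)
    ; lagging     = λ _ _ _ → <-≤-trans (subst (0 <_) cu≡du 0<u) (transfer-target-≥ d u pivot u≢p) ,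
                              target-lags
    ; sparse      = transfer-sparse c u~p
    }
    where
    u≢p   = PathAdj⇒≢ u~p
    0<u   = <-≤-trans c-pivot p≤u
    cu≡du = agree-live 0<u u≢p
    0<dp  = proj₁ (lagging u (PathAdj-sym u~p) 0<u)
    dp≤cp = proj₂ (lagging u (PathAdj-sym u~p) 0<u)
    dp≤du = ≤-trans dp≤cp (≤-trans p≤u (≤-reflexive cu≡du))
    target-lags : transfer d u pivot u ≤ transfer c u pivot u
    target-lags = begin
      transfer d u pivot u ≡⟨ transfer-target d u pivot u≢p ⟩
      d u + d pivot        ≤⟨ +-mono-≤ (≤-reflexive (sym cu≡du)) dp≤cp ⟩
      c u + c pivot        ≡⟨ sym (transfer-target c u pivot u≢p) ⟩
      transfer c u pivot u ∎
      where open ≤-Reasoning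

  copyAbsorption : ∀ {x} → PathAdj pivot x → 0 < c x → d x ≤ d pivot → Trackable (transfer c pivot x) d
  copyAbsorption {x} p~x 0<x dx≤dp =
    transfer d pivot x , return (move pivot x p~x dx≤dp 0<dx) , twoLeftovers record
    { pivot       = pivot
    ; leftover₁   = leftover₁
    ; leftover₂   = leftover₂
    ; agree       = λ i i≢p i≢e₁ i≢e₂ → transfer-cong-≢target c d pivot x i i≢p λ _ → agree i i≢p i≢e₁ i≢e₂
    ; c-leftover₁ = transfer-preserves-empty c pivot x leftover₁ c-pivot c-leftover₁
    ; c-leftover₂ = transfer-preserves-empty c pivot x leftover₂ c-pivot c-leftover₂
    ; slack       = inj₂ (leftovers-coincide (<-≤-trans 0<dx dx≤dp))
    ; c-pivot     = <-≤-trans c-pivot (transfer-target-≥ c pivot x (PathAdj⇒≢ p~x))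
    ; lagging     = λ q p~q 0<q → contradiction 0<q (transfer-isolates c sparse p~x 0<x q p~q)
    ; sparse      = transfer-sparse c p~x
    }
    where 0<dx = subst (0 <_) (agree-live 0<x (≢-sym (PathAdj⇒≢ p~x))) 0<x

  displaceAbsorption : ∀ {x} → PathAdj pivot x → 0 < c x → d pivot ≤ d x → Trackable (transfer c pivot x) d
  displaceAbsorption {x} p~x 0<x dp≤dx =
    transfer d x pivot , return (move x pivot (PathAdj-sym p~x) dp≤dx 0<dp) , twoLeftovers record
    { pivot       = pivot
    ; leftover₁   = x
    ; leftover₂   = leftover₁
    ; agree       = agree′
    ; c-leftover₁ = transfer-source c pivot x
    ; c-leftover₂ = transfer-preserves-empty c pivot x leftover₁ c-pivot c-leftover₁
    ; slack       = inj₁ (transfer-source d x pivot)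
    ; c-pivot     = <-≤-trans c-pivot (transfer-target-≥ c pivot x (PathAdj⇒≢ p~x))
    ; lagging     = λ q p~q 0<q → contradiction 0<q (transfer-isolates c sparse p~x 0<x q p~q)
    ; sparse      = transfer-sparse c p~x
    }
    where
    0<dp = proj₁ (lagging x p~x 0<x)
    agree′ : ∀ i → i ≢ pivot → i ≢ x → i ≢ leftover₁ → transfer c pivot x i ≡ transfer d x pivot i
    agree′ i i≢p i≢x i≢e₁ = begin
      transfer c pivot x i ≡⟨ transfer-other c pivot x i i≢x i≢p ⟩
      c i                  ≡⟨ agree i i≢p i≢e₁ (subst (i ≢_) (leftovers-coincide 0<dp) i≢e₁) ⟩
      d i                  ≡⟨ sym (transfer-other d x pivot i i≢p i≢x) ⟩
      transfer d x pivot i ∎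
      where open ≡-Reasoning

  pivotAbsorbs : ∀ {x} → PathAdj pivot x → 0 < c x → Trackable (transfer c pivot x) d
  pivotAbsorbs {x} p~x 0<x with d x ≤? d pivot
  ... | yes dx≤dp = copyAbsorption p~x 0<x dx≤dp
  ... | no  dx≰dp = displaceAbsorption p~x 0<x (<⇒≤ (≰⇒> dx≰dp))

  step : ∀ {c₁} → Move c c₁ → Trackable c₁ d
  step (move u x u~x x≤u 0<x) with u ≟ pivot | x ≟ pivot
  ... | no  u≢p  | no x≢p = away u~x x≤u 0<x u≢p x≢p
  ... | _        | yes refl = absorbPivot u~x x≤u
  ... | yes refl | no _    = pivotAbsorbs u~x 0<x

coupling-step : ∀ {n} {c c₁ d : Weights n} → Coupling c d → Move c c₁ → Trackable c₁ d
coupling-step (agreeing (p , agree)) = AgreeingStep.step p agree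
coupling-step (oneLeftover o)        = OneLeftoverStep.step o
coupling-step (twoLeftovers t)       = TwoLeftoversStep.step t

coupling-moves : ∀ {n} {c f d : Weights n} → Coupling c d → Moves c f → Trackable f d
coupling-moves {d = d} coupled ε = d , ε , coupled
coupling-moves coupled (c→c₁ ◅ c₁→f) with coupling-step coupled c→c₁
... | d₁ , d→d₁ , coupled₁ with coupling-moves coupled₁ c₁→f
...   | d′ , d₁→d′ , coupled′ = d′ , d→d₁ ◅◅ d₁→d′ , coupled′

oneLeftover-supportSize : ∀ {n} {c d : Weights n} → OneLeftover c d → supportSize d ≤ suc (supportSize c)
oneLeftover-supportSize {c = c} {d} o = supportSize-≤-suc leftover live
  where
  open OneLeftover o
  live : ∀ i → i ≢ leftover → 0 < d i → 0 < c i
  live i i≢e 0<di = subst (0 <_) (sym (agree i (live⇒≢empty {w = d} 0<di d-pivot) i≢e)) 0<di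

twoLeftovers-supportSize : ∀ {n} {c d : Weights n} → TwoLeftovers c d → supportSize d ≤ suc (supportSize c)
twoLeftovers-supportSize {c = c} {d} t = [ pivotEmpty , leftoversCoincide ]′ slack
  where
  open TwoLeftovers t

  leftoversCoincide : leftover₁ ≡ leftover₂ → supportSize d ≤ suc (supportSize c)
  leftoversCoincide refl = supportSize-≤-suc leftover₁ live
    where
    live : ∀ i → i ≢ leftover₁ → 0 < d i → 0 < c i
    live i i≢e 0<di with i ≟ pivot
    ... | yes refl = c-pivot
    ... | no  i≢p  = subst (0 <_) (sym (agree i i≢p i≢e i≢e)) 0<di

  pivotEmpty : d pivot ≡ 0 → supportSize d ≤ suc (supportSize c)
  pivotEmpty dp≡0 = begin
    supportSize d                           ≤⟨ supportSize-erase leftover₂ d ⟩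
    suc (supportSize (erase leftover₂ d))   ≤⟨ s≤s (supportSize-≤-suc leftover₁ live) ⟩
    suc (suc (supportSize (erase pivot c))) ≤⟨ s≤s (supportSize-erase-< c c-pivot) ⟩
    suc (supportSize c)                     ∎
    where
    open ≤-Reasoning
    live : ∀ i → i ≢ leftover₁ → 0 < erase leftover₂ d i → 0 < erase pivot c i
    live i i≢e₁ 0<i = subst (0 <_) (sym (trans (erase-other c i≢p) (agree i i≢p i≢e₁ i≢e₂))) 0<di
      where
      i≢e₂ = erase-live⇒≢ d 0<i
      0<di = subst (0 <_) (erase-other d i≢e₂) 0<i
      i≢p  = live⇒≢empty {w = d} 0<di dp≡0

coupling-supportSize : ∀ {n} {c d : Weights n} → Coupling c d → supportSize d ≤ suc (supportSize c)
coupling-supportSize (agreeing (p , agree)) = supportSize-≤-suc p λ i i≢p → subst (0 <_) (sym (agree i i≢p))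
coupling-supportSize (oneLeftover o)        = oneLeftover-supportSize o
coupling-supportSize (twoLeftovers t)       = twoLeftovers-supportSize t

AgreeExceptOne-sym : ∀ {n} {w w′ : Weights n} → AgreeExceptOne w w′ → AgreeExceptOne w′ w
AgreeExceptOne-sym (v , agree) = v , λ u u≢v → sym (agree u u≢v)

totalAcqNum-≤-suc : ∀ {n} {w w′ : Weights n} {k k′} → AgreeExceptOne w w′ →
  IsTotalAcqNum w k → IsTotalAcqNum w′ k′ → k′ ≤ suc k
totalAcqNum-≤-suc {k = k} {k′} agree ((f , w→f , _ , ∣f∣≡k) , _) (_ , minimal′)
  with coupling-moves (agreeing agree) w→f
... | d , w′→d , coupled with reachTerminal d
...   | t , d→t , terminal , ∣t∣≤∣d∣ = begin
  k′                  ≤⟨ minimal′ _ (t , w′→d ◅◅ d→t , terminal , refl) ⟩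
  residualSize t      ≡⟨ residualSize≡supportSize t ⟩
  supportSize t       ≤⟨ ∣t∣≤∣d∣ ⟩
  supportSize d       ≤⟨ coupling-supportSize coupled ⟩
  suc (supportSize f) ≡⟨ cong suc (trans (sym (residualSize≡supportSize f)) ∣f∣≡k) ⟩
  suc k               ∎
  where open ≤-Reasoning

lemma3p4 : (n : ℕ) (w w' : Weights n) → AgreeExceptOne w w' →
    (k k' : ℕ) → IsTotalAcqNum w k → IsTotalAcqNum w' k' →
    (k ≤ suc k' × k' ≤ suc k)
lemma3p4 n w w' agree k k' hk hk' =
  totalAcqNum-≤-suc (AgreeExceptOne-sym agree) hk' hk , totalAcqNum-≤-suc agree hk hk'
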